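{- For any two permutations $\sigma$ and $\pi$, \[ \mu(\sigma,\pi)= (-1)^{|\pi|-|\sigma|}E(\sigma,\pi) - \sum_{\lambda\in[\sigma,\pi)}\mu(\sigma,\lambda)\sum_{\tau\in[\lambda,\pi]}(-1)^{|\pi|-|\tau|}E(\tau,\pi). \]
   Context: A permutation of size $n$ is a bijection of $[n]$; $|\pi|$ denotes the size. For $\sigma\in\mathcal{S}_k$, $\pi\in\mathcal{S}_n$, an embedding of $\sigma$ into $\pi$ is a strictly increasing map $f\colon[k]\to[n]$ such that $\pi(f(1)),\dots,\pi(f(k))$ is order-isomorphic to $\sigma(1),\dots,\sigma(k)$; $E(\sigma,\pi)$ is the number of embeddings of $\sigma$ into $\pi$, and $\sigma\le\pi$ means $E(\sigma,\pi)>0$. In this poset, $[x,y]=\{z:x\le z\le y\}$, $[x,y)=\{z:x\le z<y\}$, and $\mu$ is its Möbius function: $\mu(x,y)=0$ if $x\not\le y$, $\mu(x,x)=1$, $\mu(x,y)=-\sum_{z\in[x,y)}\mu(x,z)$ for $x<y$. -}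

module Defs where

open import Data.Bool using (Bool; true; false; _∧_; _∨_; not; if_then_else_; T)
open import Data.Nat using (ℕ; zero; suc; _∸_; _<ᵇ_; _≡ᵇ_)
open import Data.Integer using (ℤ; -1ℤ; 0ℤ; 1ℤ; _*_; -_; _^_) renaming (_+_ to _+ℤ_)
open import Data.List using (List; []; _∷_; length; map; filter; concatMap; upTo; foldr; _++_)

any : {A : Set} → (A → Bool) → List A → Bool
any p []       = false
any p (x ∷ xs) = p x ∨ any p xs

all : {A : Set} → (A → Bool) → List A → Bool
all p []       = true
all p (x ∷ xs) = p x ∧ all p xs
open import Relation.Unary using (Pred)

-- Permutations are represented in one-line notation as lists of
-- natural numbers with values 0 .. n-1 (0-based instead of 1-based).

distinctᵇ : List ℕ → Bool
distinctᵇ []       = true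
distinctᵇ (a ∷ as) = not (any (λ b → a ≡ᵇ b) as) ∧ distinctᵇ as

isPermᵇ : List ℕ → Bool
isPermᵇ w = all (λ a → a <ᵇ length w) w ∧ distinctᵇ w

IsPerm : List ℕ → Set
IsPerm w = T (isPermᵇ w)

∣_∣ : List ℕ → ℕ
∣ w ∣ = length w

-- Order isomorphism of two sequences of distinct numbers:
-- same length and for all i < j,  a_i < a_j  iff  b_i < b_j.

sameOrderᵇ : ℕ → ℕ → ℕ → ℕ → Bool
sameOrderᵇ a x b y with a <ᵇ x | b <ᵇ y
... | true  | true  = true
... | false | false = true
... | _     | _     = false

headCompatᵇ : ℕ → List ℕ → ℕ → List ℕ → Bool
headCompatᵇ a []       b []       = true
headCompatᵇ a (x ∷ xs) b (y ∷ ys) = sameOrderᵇ a x b y ∧ headCompatᵇ a xs b ys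
headCompatᵇ a _        b _        = false

orderIsoᵇ : List ℕ → List ℕ → Bool
orderIsoᵇ []       []       = true
orderIsoᵇ (a ∷ as) (b ∷ bs) = headCompatᵇ a as b bs ∧ orderIsoᵇ as bs
orderIsoᵇ _        _        = false

subseqs : List ℕ → List (List ℕ)
subseqs []       = [] ∷ []
subseqs (a ∷ as) = map (a ∷_) (subseqs as) ++ subseqs as

E : List ℕ → List ℕ → ℕ
E σ π = length (filter (λ s → T? (orderIsoᵇ s σ)) (subseqs π))
  where
  open import Relation.Nullary.Decidable using (T?)

Eℤ : List ℕ → List ℕ → ℤ
Eℤ σ π = Data.Integer.+ (E σ π)
  where import Data.Integer

leqᵇ : List ℕ → List ℕ → Bool
leqᵇ σ π = 0 <ᵇ E σ π

_≼_ : List ℕ → List ℕ → Set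
σ ≼ π = T (leqᵇ σ π)

eqListᵇ : List ℕ → List ℕ → Bool
eqListᵇ []       []       = true
eqListᵇ (a ∷ as) (b ∷ bs) = (a ≡ᵇ b) ∧ eqListᵇ as bs
eqListᵇ _        _        = false

words : List ℕ → ℕ → List (List ℕ)
words A zero    = [] ∷ []
words A (suc k) = concatMap (λ a → map (a ∷_) (words A k)) A

permsOfSize : ℕ → List (List ℕ)
permsOfSize k = filter (λ w → T? (isPermᵇ w)) (words (upTo k) k)
  where open import Relation.Nullary.Decidable using (T?)

permsUpTo : ℕ → List (List ℕ)
permsUpTo m = concatMap permsOfSize (upTo (suc m))

filterᵇ : (List ℕ → Bool) → List (List ℕ) → List (List ℕ)
filterᵇ p []       = []
filterᵇ p (x ∷ xs) = if p x then x ∷ filterᵇ p xs else filterᵇ p xs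

-- closed interval [x, y] and half-open interval [x, y) of the poset
-- (every z ≤ y has |z| ≤ |y|, so enumerating sizes ≤ |y| suffices)
intervalCC : List ℕ → List ℕ → List (List ℕ)
intervalCC x y = filterᵇ (λ z → leqᵇ x z ∧ leqᵇ z y) (permsUpTo (length y))

intervalCO : List ℕ → List ℕ → List (List ℕ)
intervalCO x y = filterᵇ (λ z → leqᵇ x z ∧ leqᵇ z y ∧ not (eqListᵇ z y)) (permsUpTo (length y))

sumℤ : List ℤ → ℤ
sumℤ = foldr _+ℤ_ 0ℤ

-- Möbius function:  μ(x,y) = 0 if x ≰ y,  μ(x,x) = 1,
-- μ(x,y) = - Σ_{z ∈ [x,y)} μ(x,z)  for x < y.
-- Defined with fuel; every z ∈ [x,y) has |z| < |y|, so fuel |y|+1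
-- is always enough.

μAux : ℕ → List ℕ → List ℕ → ℤ
μAux zero    x y = 0ℤ
μAux (suc f) x y =
  if leqᵇ x y
  then (if eqListᵇ x y then 1ℤ else - sumℤ (map (μAux f x) (intervalCO x y)))
  else 0ℤ

μ : List ℕ → List ℕ → ℤ
μ x y = μAux (suc (length y)) x y

sgn : ℕ → ℤ
sgn k = -1ℤ ^ k

module Submission where

open import Defs
open import Data.List using (List; map)
open import Data.Nat using (ℕ; _∸_)
open import Data.Integer using (_*_; _-_)
open import Relation.Binary.PropositionalEquality using (_≡_)

open import Data.Bool using (Bool; true; false; _∧_; not; if_then_else_; T)
open import Data.Bool.Properties using (∧-assoc; ∧-identityʳ; ∧-zeroʳ)
open import Data.Empty using (⊥-elim)
open import Data.Integer as ℤ using (ℤ; 0ℤ; 1ℤ; -_; _+_)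
import Data.Integer.Properties as ℤ
open import Data.Integer.Tactic.RingSolver using (solve-∀)
open import Data.List using ([]; _∷_; _++_; concatMap; length; filter; upTo; _∷ʳ_)
import Data.List.Properties as List
open import Data.List.Membership.Propositional using (_∈_; find)
open import Data.List.Membership.Propositional.Properties
  using (∈-map⁺; ∈-map⁻; ∈-++⁺ˡ; ∈-++⁺ʳ; ∈-++⁻; ∈-filter⁺; ∈-filter⁻; ∈-concatMap⁻; ∈-upTo⁺; ∈-upTo⁻)
open import Data.List.Relation.Binary.Pointwise using (Pointwise; []; _∷_)
open import Data.List.Relation.Unary.All as All using (All; []; _∷_)
import Data.List.Relation.Unary.All.Properties as All
open import Data.List.Relation.Unary.AllPairs using ([]; _∷_)
open import Data.List.Relation.Unary.Any using (here; there)
open import Data.List.Relation.Unary.Unique.Propositional using (Unique)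
open import Data.List.Relation.Unary.Unique.Propositional.Properties using (upTo⁺)
open import Data.Nat as ℕ using (zero; suc; _≤_; _<_; z≤n; s≤s; _<ᵇ_; _≤ᵇ_; _≡ᵇ_; _≤′_; ≤′-refl; ≤′-step)
import Data.Nat.Properties as ℕ
open import Data.Product using (∃; _×_; _,_; proj₁; proj₂; map₁)
open import Data.Sum using (_⊎_; inj₁; inj₂)
open import Function using (_∘_)
open import Relation.Binary.PropositionalEquality using (refl; sym; trans; cong; cong₂; subst; module ≡-Reasoning)
open import Relation.Nullary using (¬_; yes; no)
open import Relation.Nullary.Decidable using (T?)
open import Relation.Nullary.Reflects using (Reflects; ofʸ; ofⁿ)

-- For σ ≼ π and any f, expanding [λ, π] over all permutations of size at most |π| and exchanging
-- the two sums turns  Σ_{λ ∈ [σ,π)} μ(σ,λ) Σ_{τ ∈ [λ,π]} f(τ)  into  Σ_{τ ≼ π} f(τ) Σ_{λ ∈ [σ,π), λ ≼ τ} μ(σ,λ).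
-- For τ ≠ π the inner sum ranges over all of [σ,τ] and equals δ(σ,τ) by the defining recursion
-- of μ; for τ = π it is Σ_{[σ,π)} μ(σ,·) = δ(σ,π) − μ(σ,π). So the double sum is f(σ) − μ(σ,π) f(π),
-- and f(τ) = (−1)^{|π|−|τ|} E(τ,π) has f(π) = 1 (when σ ⋠ π both sides of the identity vanish).
-- The combinatorial input is that ≼ is a partial order on permutations: antisymmetry holds because
-- order-isomorphic permutations are equal, each entry being the number of entries below it.

∧-fst : ∀ {x y} → T (x ∧ y) → T x
∧-fst {true} _ = _

∧-snd : ∀ {x y} → T (x ∧ y) → T y
∧-snd {true} t = t

∧-intro : ∀ {x y} → T x → T y → T (x ∧ y)
∧-intro {true} _ t = t

≡true⇒T : ∀ {b} → b ≡ true → T b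
≡true⇒T refl = _

T⇒≡true : ∀ {b} → T b → b ≡ true
T⇒≡true {true} _ = refl

¬T⇒≡false : ∀ {b} → ¬ T b → b ≡ false
¬T⇒≡false {true}  ¬t = ⊥-elim (¬t _)
¬T⇒≡false {false} _  = refl

-- Sums over lists

∑ : {A : Set} → (A → ℤ) → List A → ℤ
∑ f xs = sumℤ (map f xs)

∑-++ : {A : Set} (f : A → ℤ) (xs ys : List A) → ∑ f (xs ++ ys) ≡ ∑ f xs + ∑ f ys
∑-++ f []       ys = sym (ℤ.+-identityˡ _)
∑-++ f (x ∷ xs) ys = trans (cong (f x +_) (∑-++ f xs ys)) (sym (ℤ.+-assoc (f x) _ _))

∑-cong : {A : Set} {f g : A → ℤ} (xs : List A) → (∀ {x} → x ∈ xs → f x ≡ g x) → ∑ f xs ≡ ∑ g xs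
∑-cong []       f≡g = refl
∑-cong (x ∷ xs) f≡g = cong₂ _+_ (f≡g (here refl)) (∑-cong xs (f≡g ∘ there))

∑-zero : {A : Set} {f : A → ℤ} (xs : List A) → (∀ {x} → x ∈ xs → f x ≡ 0ℤ) → ∑ f xs ≡ 0ℤ
∑-zero xs f≡0 = trans (∑-cong xs f≡0) (zeros xs)
  where
  zeros : ∀ ys → ∑ (λ _ → 0ℤ) ys ≡ 0ℤ
  zeros []       = refl
  zeros (_ ∷ ys) = trans (ℤ.+-identityˡ _) (zeros ys)

∑-+ : {A : Set} (f g : A → ℤ) (xs : List A) → ∑ (λ x → f x + g x) xs ≡ ∑ f xs + ∑ g xs
∑-+ f g []       = refl
∑-+ f g (x ∷ xs) = trans (cong (f x + g x +_) (∑-+ f g xs)) (interchange (f x) (g x) _ _)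
  where
  interchange : ∀ a b c d → (a + b) + (c + d) ≡ (a + c) + (b + d)
  interchange = solve-∀

∑-neg : {A : Set} (f : A → ℤ) (xs : List A) → ∑ (λ x → - f x) xs ≡ - ∑ f xs
∑-neg f []       = refl
∑-neg f (x ∷ xs) = trans (cong (- f x +_) (∑-neg f xs)) (sym (ℤ.neg-distrib-+ (f x) _))

∑-minus : {A : Set} (f g : A → ℤ) (xs : List A) → ∑ (λ x → f x - g x) xs ≡ ∑ f xs - ∑ g xs
∑-minus f g xs = trans (∑-+ f (λ x → - g x) xs) (cong (∑ f xs +_) (∑-neg g xs))

∑-*ˡ : {A : Set} (c : ℤ) (f : A → ℤ) (xs : List A) → ∑ (λ x → c * f x) xs ≡ c * ∑ f xs
∑-*ˡ c f []       = sym (ℤ.*-zeroʳ c)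
∑-*ˡ c f (x ∷ xs) = trans (cong (c * f x +_) (∑-*ˡ c f xs)) (sym (ℤ.*-distribˡ-+ c (f x) _))

∑-*ʳ : {A : Set} (c : ℤ) (f : A → ℤ) (xs : List A) → ∑ (λ x → f x * c) xs ≡ ∑ f xs * c
∑-*ʳ c f xs = trans (∑-cong xs (λ {x} _ → ℤ.*-comm (f x) c))
                    (trans (∑-*ˡ c f xs) (ℤ.*-comm c (∑ f xs)))

∑-comm : {A B : Set} (f : A → B → ℤ) (xs : List A) (ys : List B) →
         ∑ (λ x → ∑ (f x) ys) xs ≡ ∑ (λ y → ∑ (λ x → f x y) xs) ys
∑-comm f []       ys = sym (∑-zero ys (λ _ → refl))
∑-comm f (x ∷ xs) ys =
  trans (cong (∑ (f x) ys +_) (∑-comm f xs ys)) (sym (∑-+ (f x) (λ y → ∑ (λ x → f x y) xs) ys))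

∑-map : {A B : Set} (f : B → ℤ) (g : A → B) (xs : List A) → ∑ f (map g xs) ≡ ∑ (f ∘ g) xs
∑-map f g []       = refl
∑-map f g (x ∷ xs) = cong (f (g x) +_) (∑-map f g xs)

∑-concatMap : {A B : Set} (f : B → ℤ) (g : A → List B) (xs : List A) →
              ∑ f (concatMap g xs) ≡ ∑ (λ x → ∑ f (g x)) xs
∑-concatMap f g []       = refl
∑-concatMap f g (x ∷ xs) = trans (∑-++ f (g x) (concatMap g xs)) (cong (∑ f (g x) +_) (∑-concatMap f g xs))

when : Bool → ℤ → ℤ
when b z = if b then z else 0ℤ

when-0 : ∀ b → when b 0ℤ ≡ 0ℤ
when-0 true  = refl
when-0 false = refl

*-when : ∀ b m z → m * when b z ≡ when b m * z
*-when true  m z = refl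
*-when false m z = trans (ℤ.*-zeroʳ m) (sym (ℤ.*-zeroˡ z))

when-*ʳ : ∀ b m z → when b m * z ≡ when b (m * z)
when-*ʳ true  m z = refl
when-*ʳ false m z = ℤ.*-zeroˡ z

when-split : ∀ c e v → when c v ≡ when (c ∧ not e) v + when e (when c v)
when-split true  true  v = sym (ℤ.+-identityˡ v)
when-split true  false v = sym (ℤ.+-identityʳ v)
when-split false true  v = refl
when-split false false v = refl

when-distrib : ∀ b c m z → (when b 1ℤ - when c m) * z ≡ when b z - when c (m * z)
when-distrib b c m z = begin
  (when b 1ℤ - when c m) * z          ≡⟨ ℤ.*-distribʳ-+ z (when b 1ℤ) (- when c m) ⟩
  when b 1ℤ * z + - when c m * z      ≡⟨ cong₂ _+_ (when-*ʳ b 1ℤ z) (sym (ℤ.neg-distribˡ-* (when c m) z)) ⟩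
  when b (1ℤ * z) - when c m * z      ≡⟨ cong₂ (λ u v → when b u - v) (ℤ.*-identityˡ z) (when-*ʳ c m z) ⟩
  when b z - when c (m * z)           ∎
  where open ≡-Reasoning

∑-filter : {A : Set} (f : A → ℤ) (p : A → Bool) (xs : List A) →
           ∑ f (filter (T? ∘ p) xs) ≡ ∑ (λ x → when (p x) (f x)) xs
∑-filter f p []       = refl
∑-filter f p (x ∷ xs) with p x
... | true  = cong (f x +_) (∑-filter f p xs)
... | false = trans (∑-filter f p xs) (sym (ℤ.+-identityˡ _))

∑-filterᵇ : (f : List ℕ → ℤ) (p : List ℕ → Bool) (xs : List (List ℕ)) →
            ∑ f (filterᵇ p xs) ≡ ∑ (λ x → when (p x) (f x)) xs
∑-filterᵇ f p [] = refl
∑-filterᵇ f p (x ∷ xs) with p x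
... | true  = cong (f x +_) (∑-filterᵇ f p xs)
... | false = trans (∑-filterᵇ f p xs) (sym (ℤ.+-identityˡ _))

-- Subsequences and the containment order

pick : List Bool → List ℕ → List ℕ
pick []          w       = []
pick (_ ∷ _)     []      = []
pick (true ∷ m)  (a ∷ w) = a ∷ pick m w
pick (false ∷ m) (a ∷ w) = pick m w

pick-∈-subseqs : (m : List Bool) (w : List ℕ) → pick m w ∈ subseqs w
pick-∈-subseqs []          []      = here refl
pick-∈-subseqs []          (a ∷ w) = ∈-++⁺ʳ (map (a ∷_) (subseqs w)) (pick-∈-subseqs [] w)
pick-∈-subseqs (_ ∷ m)     []      = here refl
pick-∈-subseqs (true ∷ m)  (a ∷ w) = ∈-++⁺ˡ (∈-map⁺ (a ∷_) (pick-∈-subseqs m w))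
pick-∈-subseqs (false ∷ m) (a ∷ w) = ∈-++⁺ʳ (map (a ∷_) (subseqs w)) (pick-∈-subseqs m w)

∈-subseqs⇒pick : (w : List ℕ) {s : List ℕ} → s ∈ subseqs w → ∃ λ m → pick m w ≡ s
∈-subseqs⇒pick []      (here refl) = [] , refl
∈-subseqs⇒pick (a ∷ w) s∈ with ∈-++⁻ (map (a ∷_) (subseqs w)) s∈
... | inj₂ s∈′ = let m , eq = ∈-subseqs⇒pick w s∈′ in false ∷ m , eq
... | inj₁ s∈′ with ∈-map⁻ (a ∷_) s∈′
...   | t , t∈ , refl = let m , eq = ∈-subseqs⇒pick w t∈ in true ∷ m , cong (a ∷_) eq

length-pick : (m : List Bool) (w : List ℕ) → length (pick m w) ≤ length w
length-pick []          w       = z≤n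
length-pick (_ ∷ m)     []      = z≤n
length-pick (true ∷ m)  (a ∷ w) = s≤s (length-pick m w)
length-pick (false ∷ m) (a ∷ w) = ℕ.m≤n⇒m≤1+n (length-pick m w)

pick-full : (m : List Bool) (w : List ℕ) → length (pick m w) ≡ length w → pick m w ≡ w
pick-full []          []      eq = refl
pick-full (_ ∷ m)     []      eq = refl
pick-full (true ∷ m)  (a ∷ w) eq = cong (a ∷_) (pick-full m w (ℕ.suc-injective eq))
pick-full (false ∷ m) (a ∷ w) eq = ⊥-elim (ℕ.<⇒≱ (s≤s (length-pick m w)) (ℕ.≤-reflexive (sym eq)))

pick-pick : (m₁ m₂ : List Bool) (w : List ℕ) → ∃ λ m → pick m₁ (pick m₂ w) ≡ pick m w
pick-pick []           m₂           w       = [] , refl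
pick-pick (_ ∷ m₁)     []           w       = [] , refl
pick-pick (_ ∷ m₁)     (_ ∷ m₂)     []      = [] , refl
pick-pick (true ∷ m₁)  (true ∷ m₂)  (a ∷ w) = let m , eq = pick-pick m₁ m₂ w in true ∷ m , cong (a ∷_) eq
pick-pick (false ∷ m₁) (true ∷ m₂)  (a ∷ w) = let m , eq = pick-pick m₁ m₂ w in false ∷ m , eq
pick-pick (b ∷ m₁)     (false ∷ m₂) (a ∷ w) = let m , eq = pick-pick (b ∷ m₁) m₂ w in false ∷ m , eq

subseqs-head : (w : List ℕ) → ∃ λ rest → subseqs w ≡ w ∷ rest × All (λ s → length s < length w) rest
subseqs-head []      = [] , refl , []
subseqs-head (a ∷ w) with subseqs w | subseqs-head w
... | _ | rest , refl , shorter =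
  map (a ∷_) rest ++ (w ∷ rest) , refl ,
  All.++⁺ (All.map⁺ (All.map s≤s shorter)) (ℕ.≤-refl ∷ All.map ℕ.m<n⇒m<1+n shorter)

sameOrderᵇ⇒≡ : ∀ a x b y → T (sameOrderᵇ a x b y) → (a <ᵇ x) ≡ (b <ᵇ y)
sameOrderᵇ⇒≡ a x b y t with a <ᵇ x | b <ᵇ y
... | true  | true  = refl
... | false | false = refl

≡⇒sameOrderᵇ : ∀ a x b y → (a <ᵇ x) ≡ (b <ᵇ y) → T (sameOrderᵇ a x b y)
≡⇒sameOrderᵇ a x b y eq with a <ᵇ x | b <ᵇ y
≡⇒sameOrderᵇ a x b y eq | true  | true  = _
≡⇒sameOrderᵇ a x b y eq | false | false = _
≡⇒sameOrderᵇ a x b y () | true  | false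
≡⇒sameOrderᵇ a x b y () | false | true

headCompatᵇ-length : ∀ a xs b ys → T (headCompatᵇ a xs b ys) → length xs ≡ length ys
headCompatᵇ-length a []       b []       _ = refl
headCompatᵇ-length a (x ∷ xs) b (y ∷ ys) t = cong suc (headCompatᵇ-length a xs b ys (∧-snd t))

headCompatᵇ-pick : ∀ m a xs b ys → T (headCompatᵇ a xs b ys) → T (headCompatᵇ a (pick m xs) b (pick m ys))
headCompatᵇ-pick []          a xs       b ys       t = _
headCompatᵇ-pick (_ ∷ m)     a []       b []       t = _
headCompatᵇ-pick (true ∷ m)  a (x ∷ xs) b (y ∷ ys) t = ∧-intro (∧-fst t) (headCompatᵇ-pick m a xs b ys (∧-snd t))
headCompatᵇ-pick (false ∷ m) a (x ∷ xs) b (y ∷ ys) t = headCompatᵇ-pick m a xs b ys (∧-snd {sameOrderᵇ a x b y} t)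

headCompatᵇ-trans : ∀ a xs b ys c zs →
  T (headCompatᵇ a xs b ys) → T (headCompatᵇ b ys c zs) → T (headCompatᵇ a xs c zs)
headCompatᵇ-trans a []       b []       c []       t u = _
headCompatᵇ-trans a (x ∷ xs) b (y ∷ ys) c (z ∷ zs) t u =
  ∧-intro (≡⇒sameOrderᵇ a x c z (trans (sameOrderᵇ⇒≡ a x b y (∧-fst t)) (sameOrderᵇ⇒≡ b y c z (∧-fst u))))
          (headCompatᵇ-trans a xs b ys c zs (∧-snd {sameOrderᵇ a x b y} t) (∧-snd {sameOrderᵇ b y c z} u))

headCompatᵇ-refl : ∀ a xs → T (headCompatᵇ a xs a xs)
headCompatᵇ-refl a []       = _
headCompatᵇ-refl a (x ∷ xs) = ∧-intro (≡⇒sameOrderᵇ a x a x refl) (headCompatᵇ-refl a xs)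

orderIsoᵇ-length : ∀ xs ys → T (orderIsoᵇ xs ys) → length xs ≡ length ys
orderIsoᵇ-length []       []       _ = refl
orderIsoᵇ-length (x ∷ xs) (y ∷ ys) t = cong suc (orderIsoᵇ-length xs ys (∧-snd {headCompatᵇ x xs y ys} t))

orderIsoᵇ-pick : ∀ m xs ys → T (orderIsoᵇ xs ys) → T (orderIsoᵇ (pick m xs) (pick m ys))
orderIsoᵇ-pick []          xs       ys       t = _
orderIsoᵇ-pick (_ ∷ m)     []       []       t = _
orderIsoᵇ-pick (true ∷ m)  (x ∷ xs) (y ∷ ys) t =
  ∧-intro (headCompatᵇ-pick m x xs y ys (∧-fst t)) (orderIsoᵇ-pick m xs ys (∧-snd {headCompatᵇ x xs y ys} t))
orderIsoᵇ-pick (false ∷ m) (x ∷ xs) (y ∷ ys) t = orderIsoᵇ-pick m xs ys (∧-snd {headCompatᵇ x xs y ys} t)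

orderIsoᵇ-trans : ∀ xs ys zs → T (orderIsoᵇ xs ys) → T (orderIsoᵇ ys zs) → T (orderIsoᵇ xs zs)
orderIsoᵇ-trans []       []       []       t u = _
orderIsoᵇ-trans (x ∷ xs) (y ∷ ys) (z ∷ zs) t u =
  ∧-intro (headCompatᵇ-trans x xs y ys z zs (∧-fst t) (∧-fst u))
          (orderIsoᵇ-trans xs ys zs (∧-snd {headCompatᵇ x xs y ys} t) (∧-snd {headCompatᵇ y ys z zs} u))

orderIsoᵇ-refl : ∀ xs → T (orderIsoᵇ xs xs)
orderIsoᵇ-refl []       = _
orderIsoᵇ-refl (x ∷ xs) = ∧-intro (headCompatᵇ-refl x xs) (orderIsoᵇ-refl xs)

E-refl : ∀ w → E w w ≡ 1
E-refl w with subseqs w | subseqs-head w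
... | _ | rest , refl , shorter with orderIsoᵇ w w | orderIsoᵇ-refl w
...   | true | _ = cong suc (cong length (List.filter-none (λ s → T? (orderIsoᵇ s w))
                    (All.map (λ {s} s<w iso → ℕ.<-irrefl (orderIsoᵇ-length s w iso) s<w) shorter)))

E-≰ : ∀ σ π → ¬ σ ≼ π → E σ π ≡ 0
E-≰ σ π σ⋠π with E σ π
... | zero  = refl
... | suc _ = ⊥-elim (σ⋠π _)

≼⇒embedding : ∀ σ π → σ ≼ π → ∃ λ m → T (orderIsoᵇ (pick m π) σ)
≼⇒embedding σ π σ≼π with filter (λ s → T? (orderIsoᵇ s σ)) (subseqs π) in eq
... | s ∷ _ with ∈-filter⁻ (λ s → T? (orderIsoᵇ s σ)) (subst (s ∈_) (sym eq) (here refl))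
...   | s∈ , iso with ∈-subseqs⇒pick π s∈
...     | m , refl = m , iso

embedding⇒≼ : ∀ σ π m → T (orderIsoᵇ (pick m π) σ) → σ ≼ π
embedding⇒≼ σ π m iso with filter (λ s → T? (orderIsoᵇ s σ)) (subseqs π)
                          | ∈-filter⁺ (λ s → T? (orderIsoᵇ s σ)) (pick-∈-subseqs m π) iso
... | _ ∷ _ | _ = _

≼-refl : ∀ w → w ≼ w
≼-refl w = subst (λ n → T (0 <ᵇ n)) (sym (E-refl w)) _

≼-trans : ∀ a b c → a ≼ b → b ≼ c → a ≼ c
≼-trans a b c a≼b b≼c with ≼⇒embedding a b a≼b | ≼⇒embedding b c b≼c
... | m₁ , iso₁ | m₂ , iso₂ with pick-pick m₁ m₂ c
...   | m , eq = embedding⇒≼ a c m (subst (λ s → T (orderIsoᵇ s a)) eq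
                   (orderIsoᵇ-trans (pick m₁ (pick m₂ c)) (pick m₁ b) a (orderIsoᵇ-pick m₁ (pick m₂ c) b iso₂) iso₁))

≼⇒length≤ : ∀ σ π → σ ≼ π → length σ ≤ length π
≼⇒length≤ σ π σ≼π with ≼⇒embedding σ π σ≼π
... | m , iso = subst (_≤ length π) (orderIsoᵇ-length (pick m π) σ iso) (length-pick m π)

-- Order-isomorphic permutations are equal

countᵇ : (ℕ → Bool) → List ℕ → ℕ
countᵇ p []       = 0
countᵇ p (x ∷ xs) = (if p x then 1 else 0) ℕ.+ countᵇ p xs

countᵇ-cong : ∀ {p q} xs → (∀ {x} → x ∈ xs → p x ≡ q x) → countᵇ p xs ≡ countᵇ q xs
countᵇ-cong []       p≡q = refl
countᵇ-cong (x ∷ xs) p≡q = cong₂ (λ b n → (if b then 1 else 0) ℕ.+ n) (p≡q (here refl)) (countᵇ-cong xs (p≡q ∘ there))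

countᵇ-none : ∀ {p} xs → All (λ x → ¬ T (p x)) xs → countᵇ p xs ≡ 0
countᵇ-none {p} []       []         = refl
countᵇ-none {p} (x ∷ xs) (¬px ∷ ¬ps) with p x
... | true  = ⊥-elim (¬px _)
... | false = countᵇ-none xs ¬ps

countᵇ-mono : ∀ {p q} xs → (∀ {x} → x ∈ xs → T (p x) → T (q x)) → countᵇ p xs ≤ countᵇ q xs
countᵇ-mono {p} {q} []       p⇒q = z≤n
countᵇ-mono {p} {q} (x ∷ xs) p⇒q with p x | q x | p⇒q (here refl)
... | true  | true  | _    = s≤s (countᵇ-mono xs (p⇒q ∘ there))
... | true  | false | p⇒q₀ = ⊥-elim (p⇒q₀ _)
... | false | _     | _    = ℕ.≤-trans (countᵇ-mono xs (p⇒q ∘ there)) (ℕ.m≤n+m _ _)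

countᵇ-union : ∀ {p q r} xs → (∀ {x} → T (p x) → T (q x) ⊎ T (r x)) →
               countᵇ p xs ≤ countᵇ q xs ℕ.+ countᵇ r xs
countᵇ-union {p} {q} {r} []       p⇒q∨r = z≤n
countᵇ-union {p} {q} {r} (x ∷ xs) p⇒q∨r
  with ih ← countᵇ-union xs p⇒q∨r | p x | q x | r x | p⇒q∨r {x}
... | false | qx    | rx    | _ =
  ℕ.≤-trans ih (ℕ.+-mono-≤ (ℕ.m≤n+m (countᵇ q xs) (if qx then 1 else 0)) (ℕ.m≤n+m (countᵇ r xs) (if rx then 1 else 0)))
... | true  | true  | rx    | _ =
  s≤s (ℕ.≤-trans ih (ℕ.+-monoʳ-≤ (countᵇ q xs) (ℕ.m≤n+m (countᵇ r xs) (if rx then 1 else 0))))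
... | true  | false | true  | _ = ℕ.≤-trans (s≤s ih) (ℕ.≤-reflexive (sym (ℕ.+-suc _ _)))
... | true  | false | false | p⇒q∨r₀ with p⇒q∨r₀ _
...   | inj₁ ()
...   | inj₂ ()

countᵇ-complement : ∀ p xs → countᵇ p xs ℕ.+ countᵇ (not ∘ p) xs ≡ length xs
countᵇ-complement p []       = refl
countᵇ-complement p (x ∷ xs) with p x
... | true  = cong suc (countᵇ-complement p xs)
... | false = trans (ℕ.+-suc _ _) (cong suc (countᵇ-complement p xs))

countᵇ-≡ᵇ-unique : ∀ c xs → Unique xs → countᵇ (_≡ᵇ c) xs ≤ 1
countᵇ-≡ᵇ-unique c []       []          = z≤n
countᵇ-≡ᵇ-unique c (x ∷ xs) (x∉ ∷ uniq) with x ≡ᵇ c in eq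
... | false = countᵇ-≡ᵇ-unique c xs uniq
... | true  = s≤s (ℕ.≤-reflexive (countᵇ-none xs (All.map (λ x≢y y≡c → x≢y (trans x≡c (sym (ℕ.≡ᵇ⇒≡ _ c y≡c))))
                                                            x∉)))
  where x≡c = ℕ.≡ᵇ⇒≡ x c (≡true⇒T eq)

-- lo ≤ x < lo + d: a width rather than an upper bound, so the pigeonhole induction needs no truncated subtraction.
inRangeᵇ : ℕ → ℕ → ℕ → Bool
inRangeᵇ lo d x = (lo ≤ᵇ x) ∧ (x <ᵇ lo ℕ.+ d)

countᵇ-inRange-unique : ∀ lo d xs → Unique xs → countᵇ (inRangeᵇ lo d) xs ≤ d
countᵇ-inRange-unique lo zero xs uniq =
  ℕ.≤-reflexive (countᵇ-none xs (All.universal empty xs))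
  where
  empty : ∀ x → ¬ T (inRangeᵇ lo 0 x)
  empty x t = ℕ.<⇒≱ (ℕ.<ᵇ⇒< x (lo ℕ.+ 0) (∧-snd {lo ≤ᵇ x} t))
                    (subst (_≤ x) (sym (ℕ.+-identityʳ lo)) (ℕ.≤ᵇ⇒≤ lo x (∧-fst t)))
countᵇ-inRange-unique lo (suc d) xs uniq = begin
  countᵇ (inRangeᵇ lo (suc d)) xs
    ≤⟨ countᵇ-union xs (λ {x} → split x) ⟩
  countᵇ (_≡ᵇ lo ℕ.+ d) xs ℕ.+ countᵇ (inRangeᵇ lo d) xs
    ≤⟨ ℕ.+-mono-≤ (countᵇ-≡ᵇ-unique _ xs uniq) (countᵇ-inRange-unique lo d xs uniq) ⟩
  suc d
    ∎
  where
  open ℕ.≤-Reasoning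
  split : ∀ x → T (inRangeᵇ lo (suc d) x) → T (x ≡ᵇ lo ℕ.+ d) ⊎ T (inRangeᵇ lo d x)
  split x t with x ℕ.≟ lo ℕ.+ d
  ... | yes x≡ = inj₁ (ℕ.≡⇒≡ᵇ x _ x≡)
  ... | no  x≢ = inj₂ (∧-intro (∧-fst t) (ℕ.<⇒<ᵇ (ℕ.≤∧≢⇒< x≤ x≢)))
    where
    x≤ : x ≤ lo ℕ.+ d
    x≤ = ℕ.≤-pred (subst (x <_) (ℕ.+-suc lo d) (ℕ.<ᵇ⇒< x _ (∧-snd {lo ≤ᵇ x} t)))

T-all⇒All : ∀ {p : ℕ → Bool} xs → T (all p xs) → All (T ∘ p) xs
T-all⇒All {p} []       _ = []
T-all⇒All {p} (x ∷ xs) t = ∧-fst t ∷ T-all⇒All xs (∧-snd {p x} t)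

T-distinctᵇ⇒Unique : ∀ xs → T (distinctᵇ xs) → Unique xs
T-distinctᵇ⇒Unique []       _ = []
T-distinctᵇ⇒Unique (a ∷ as) t = fresh as (∧-fst t) ∷ T-distinctᵇ⇒Unique as (∧-snd {not (any (a ≡ᵇ_) as)} t)
  where
  fresh : ∀ bs → T (not (any (a ≡ᵇ_) bs)) → All (λ b → ¬ a ≡ b) bs
  fresh []       _ = []
  fresh (b ∷ bs) t with a ≡ᵇ b in eq
  ... | false = (λ a≡b → subst T eq (ℕ.≡⇒≡ᵇ a b a≡b)) ∷ fresh bs t

isPerm⇒bounded : ∀ w → IsPerm w → All (_< length w) w
isPerm⇒bounded w pw = All.map (ℕ.<ᵇ⇒< _ _) (T-all⇒All {_<ᵇ length w} w (∧-fst pw))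

isPerm⇒unique : ∀ w → IsPerm w → Unique w
isPerm⇒unique w pw = T-distinctᵇ⇒Unique w (∧-snd {all (_<ᵇ length w) w} pw)

rank : ℕ → List ℕ → ℕ
rank k w = countᵇ (_<ᵇ k) w

-- Pigeonhole on both sides of k: at most k entries lie below k and at most n ∸ k lie in [k, n).
rank-perm : ∀ w k → IsPerm w → k ≤ length w → rank k w ≡ k
rank-perm w k pw k≤n = ℕ.≤-antisym below≤k k≤below
  where
  n = length w
  uniq = isPerm⇒unique w pw
  above = countᵇ (not ∘ (_<ᵇ k)) w
  below≤k : rank k w ≤ k
  below≤k = ℕ.≤-trans (countᵇ-mono w (λ _ t → t)) (countᵇ-inRange-unique 0 k w uniq)
  inUpper : ∀ {x} → x ∈ w → T (not (x <ᵇ k)) → T (inRangeᵇ k (n ∸ k) x)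
  inUpper {x} x∈ t with x <ᵇ k in eq
  ... | false = ∧-intro {k ≤ᵇ x} (ℕ.≤⇒≤ᵇ (ℕ.≮⇒≥ {x} {k} (λ x<k → subst T eq (ℕ.<⇒<ᵇ x<k))))
                        (ℕ.<⇒<ᵇ (subst (x <_) (sym (ℕ.m+[n∸m]≡n k≤n)) (All.lookup (isPerm⇒bounded w pw) x∈)))
  above≤ : above ≤ n ∸ k
  above≤ = ℕ.≤-trans (countᵇ-mono w inUpper) (countᵇ-inRange-unique k (n ∸ k) w uniq)
  k≤below : k ≤ rank k w
  k≤below = ℕ.+-cancelʳ-≤ (n ∸ k) k (rank k w) (begin
    k ℕ.+ (n ∸ k)         ≡⟨ ℕ.m+[n∸m]≡n k≤n ⟩
    n                     ≡⟨ sym (countᵇ-complement (_<ᵇ k) w) ⟩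
    rank k w ℕ.+ above    ≤⟨ ℕ.+-monoʳ-≤ (rank k w) above≤ ⟩
    rank k w ℕ.+ (n ∸ k)  ∎)
    where open ℕ.≤-Reasoning

rank-+-above : ∀ a xs → All (λ x → ¬ a ≡ x) xs → rank a xs ℕ.+ countᵇ (a <ᵇ_) xs ≡ length xs
rank-+-above a xs a∉ = trans (cong (rank a xs ℕ.+_) (countᵇ-cong xs flip)) (countᵇ-complement (_<ᵇ a) xs)
  where
  flip : ∀ {x} → x ∈ xs → (a <ᵇ x) ≡ not (x <ᵇ a)
  flip {x} x∈ with a <ᵇ x in e₁ | x <ᵇ a in e₂
  ... | true  | false = refl
  ... | false | true  = refl
  ... | true  | true  = ⊥-elim (ℕ.<-asym (ℕ.<ᵇ⇒< a x (≡true⇒T e₁)) (ℕ.<ᵇ⇒< x a (≡true⇒T e₂)))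
  ... | false | false = ⊥-elim (All.lookup a∉ x∈ (ℕ.≤-antisym
                          (ℕ.≮⇒≥ (λ x<a → subst T e₂ (ℕ.<⇒<ᵇ x<a))) (ℕ.≮⇒≥ (λ a<x → subst T e₁ (ℕ.<⇒<ᵇ a<x)))))

headCompatᵇ-above : ∀ a xs b ys → T (headCompatᵇ a xs b ys) → countᵇ (a <ᵇ_) xs ≡ countᵇ (b <ᵇ_) ys
headCompatᵇ-above a []       b []       _ = refl
headCompatᵇ-above a (x ∷ xs) b (y ∷ ys) t =
  cong₂ (λ c n → (if c then 1 else 0) ℕ.+ n) (sameOrderᵇ⇒≡ a x b y (∧-fst t))
        (headCompatᵇ-above a xs b ys (∧-snd {sameOrderᵇ a x b y} t))

headCompatᵇ-rank-∷ : ∀ {W V} a xs b ys → T (headCompatᵇ a xs b ys) →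
  Pointwise (λ x y → rank x W ≡ rank y V) xs ys →
  Pointwise (λ x y → rank x (a ∷ W) ≡ rank y (b ∷ V)) xs ys
headCompatᵇ-rank-∷         a []       b []       _ []         = []
headCompatᵇ-rank-∷ {W} {V} a (x ∷ xs) b (y ∷ ys) t (eq ∷ eqs) =
  cong₂ (λ c n → (if c then 1 else 0) ℕ.+ n) (sameOrderᵇ⇒≡ a x b y (∧-fst t)) eq
  ∷ headCompatᵇ-rank-∷ {W} {V} a xs b ys (∧-snd {sameOrderᵇ a x b y} t) eqs

n<ᵇn : ∀ n → (n <ᵇ n) ≡ false
n<ᵇn zero    = refl
n<ᵇn (suc n) = n<ᵇn n

orderIsoᵇ⇒rank : ∀ w v → T (orderIsoᵇ w v) → Unique w → Unique v →
  Pointwise (λ x y → rank x w ≡ rank y v) w v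
orderIsoᵇ⇒rank []       []       _ _            _            = []
orderIsoᵇ⇒rank (a ∷ as) (b ∷ bs) t (a∉ ∷ uniqᵃ) (b∉ ∷ uniqᵇ) =
  head ∷ headCompatᵇ-rank-∷ {as} {bs} a as b bs hc (orderIsoᵇ⇒rank as bs (∧-snd {headCompatᵇ a as b bs} t) uniqᵃ uniqᵇ)
  where
  hc = ∧-fst t
  head : rank a (a ∷ as) ≡ rank b (b ∷ bs)
  head rewrite n<ᵇn a | n<ᵇn b = ℕ.+-cancelʳ-≡ (countᵇ (b <ᵇ_) bs) (rank a as) (rank b bs) (begin
    rank a as ℕ.+ countᵇ (b <ᵇ_) bs  ≡⟨ cong (rank a as ℕ.+_) (sym (headCompatᵇ-above a as b bs hc)) ⟩
    rank a as ℕ.+ countᵇ (a <ᵇ_) as  ≡⟨ rank-+-above a as a∉ ⟩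
    length as                        ≡⟨ headCompatᵇ-length a as b bs hc ⟩
    length bs                        ≡⟨ sym (rank-+-above b bs b∉) ⟩
    rank b bs ℕ.+ countᵇ (b <ᵇ_) bs  ∎)
    where open ≡-Reasoning

pointwise-≡ : ∀ {f g : ℕ → ℕ} {xs ys} → Pointwise (λ x y → f x ≡ g y) xs ys →
  All (λ x → f x ≡ x) xs → All (λ y → g y ≡ y) ys → xs ≡ ys
pointwise-≡ []             []             []             = refl
pointwise-≡ (fx≡gy ∷ eqs) (fx≡x ∷ fixˡ) (gy≡y ∷ fixʳ) =
  cong₂ _∷_ (trans (sym fx≡x) (trans fx≡gy gy≡y)) (pointwise-≡ eqs fixˡ fixʳ)

orderIsoᵇ-perm⇒≡ : ∀ w v → IsPerm w → IsPerm v → T (orderIsoᵇ w v) → w ≡ v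
orderIsoᵇ-perm⇒≡ w v pw pv iso =
  pointwise-≡ (orderIsoᵇ⇒rank w v iso (isPerm⇒unique w pw) (isPerm⇒unique v pv)) (rank-fixed w pw) (rank-fixed v pv)
  where
  rank-fixed : ∀ u → IsPerm u → All (λ x → rank x u ≡ x) u
  rank-fixed u pu = All.map (λ x<n → rank-perm u _ pu (ℕ.<⇒≤ x<n)) (isPerm⇒bounded u pu)

≼-length≡⇒≡ : ∀ σ π → IsPerm σ → IsPerm π → σ ≼ π → length σ ≡ length π → σ ≡ π
≼-length≡⇒≡ σ π pσ pπ σ≼π |σ|≡|π| with ≼⇒embedding σ π σ≼π
... | m , iso = sym (orderIsoᵇ-perm⇒≡ π σ pπ pσ
                  (subst (λ s → T (orderIsoᵇ s σ)) (pick-full m π (trans (orderIsoᵇ-length (pick m π) σ iso) |σ|≡|π|)) iso))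

≼-antisym : ∀ σ π → IsPerm σ → IsPerm π → σ ≼ π → π ≼ σ → σ ≡ π
≼-antisym σ π pσ pπ σ≼π π≼σ =
  ≼-length≡⇒≡ σ π pσ pπ σ≼π (ℕ.≤-antisym (≼⇒length≤ σ π σ≼π) (≼⇒length≤ π σ π≼σ))

-- The enumeration of permutations

eqListᵇ-refl : ∀ x → eqListᵇ x x ≡ true
eqListᵇ-refl []      = refl
eqListᵇ-refl (a ∷ x) with a ≡ᵇ a | ℕ.≡⇒≡ᵇ a a refl
... | true | _ = eqListᵇ-refl x

eqListᵇ⇒≡ : ∀ x y → T (eqListᵇ x y) → x ≡ y
eqListᵇ⇒≡ []      []      _ = refl
eqListᵇ⇒≡ (a ∷ x) (b ∷ y) t = cong₂ _∷_ (ℕ.≡ᵇ⇒≡ a b (∧-fst t)) (eqListᵇ⇒≡ x y (∧-snd {a ≡ᵇ b} t))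

eqListᵇ-reflects : ∀ x y → Reflects (x ≡ y) (eqListᵇ x y)
eqListᵇ-reflects x y with eqListᵇ x y in eq
... | true  = ofʸ (eqListᵇ⇒≡ x y (≡true⇒T eq))
... | false = ofⁿ (λ { refl → subst T eq (≡true⇒T (eqListᵇ-refl x)) })

eqListᵇ-sym : ∀ x y → eqListᵇ x y ≡ eqListᵇ y x
eqListᵇ-sym x y with eqListᵇ x y | eqListᵇ-reflects x y | eqListᵇ y x | eqListᵇ-reflects y x
... | true  | _       | true  | _       = refl
... | false | _       | false | _       = refl
... | true  | ofʸ x≡y | false | ofⁿ y≢x = ⊥-elim (y≢x (sym x≡y))
... | false | ofⁿ x≢y | true  | ofʸ y≡x = ⊥-elim (x≢y (sym y≡x))

∑-δ-unique : ∀ {c b} xs → Unique xs → b ∈ xs → ∑ (λ a → when (a ≡ᵇ b) c) xs ≡ c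
∑-δ-unique {c} {b} (x ∷ xs) (x∉ ∷ uniq) (here refl) with x ≡ᵇ x | ℕ.≡⇒≡ᵇ x x refl
... | true | _ = trans (cong (c +_) (∑-zero xs others)) (ℤ.+-identityʳ c)
  where
  others : ∀ {a} → a ∈ xs → when (a ≡ᵇ x) c ≡ 0ℤ
  others {a} a∈ with a ≡ᵇ x in eq
  ... | false = refl
  ... | true  = ⊥-elim (All.lookup x∉ a∈ (sym (ℕ.≡ᵇ⇒≡ a x (≡true⇒T eq))))
∑-δ-unique {c} {b} (x ∷ xs) (x∉ ∷ uniq) (there b∈) with x ≡ᵇ b in eq
... | false = trans (ℤ.+-identityˡ _) (∑-δ-unique xs uniq b∈)
... | true  = ⊥-elim (All.lookup x∉ b∈ (ℕ.≡ᵇ⇒≡ x b (≡true⇒T eq)))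

words-length : ∀ A k {z} → z ∈ words A k → length z ≡ k
words-length A zero    (here refl) = refl
words-length A (suc k) z∈ with find (∈-concatMap⁻ (λ a → map (a ∷_) (words A k)) {xs = A} z∈)
... | a , _ , z∈′ with ∈-map⁻ (a ∷_) z∈′
...   | w , w∈ , refl = cong suc (words-length A k w∈)

∈-permsOfSize⁻ : ∀ j {z} → z ∈ permsOfSize j → IsPerm z × length z ≡ j
∈-permsOfSize⁻ j z∈ with ∈-filter⁻ (T? ∘ isPermᵇ) {xs = words (upTo j) j} z∈
... | z∈words , pz = pz , words-length (upTo j) j z∈words

∈-permsUpTo⁻ : ∀ m {z} → z ∈ permsUpTo m → IsPerm z × length z ≤ m
∈-permsUpTo⁻ m z∈ with find (∈-concatMap⁻ permsOfSize {xs = upTo (suc m)} z∈)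
... | j , j∈ , z∈′ with ∈-permsOfSize⁻ j z∈′
...   | pz , refl = pz , ℕ.≤-pred (∈-upTo⁻ j∈)

∑-words-δ : ∀ A k y (h : List ℕ → ℤ) → Unique A → All (_∈ A) y → length y ≡ k →
            ∑ (λ z → when (eqListᵇ z y) (h z)) (words A k) ≡ h y
∑-words-δ A zero    []      h uniq []          _     = ℤ.+-identityʳ (h [])
∑-words-δ A (suc k) (b ∷ y) h uniq (b∈ ∷ y⊆A) |y|≡ = begin
  ∑ g (concatMap (λ a → map (a ∷_) (words A k)) A) ≡⟨ ∑-concatMap g (λ a → map (a ∷_) (words A k)) A ⟩
  ∑ (λ a → ∑ g (map (a ∷_) (words A k))) A         ≡⟨ ∑-cong A (λ {a} _ → trans (∑-map g (a ∷_) (words A k)) (firstLetter a)) ⟩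
  ∑ (λ a → when (a ≡ᵇ b) (h (b ∷ y))) A            ≡⟨ ∑-δ-unique A uniq b∈ ⟩
  h (b ∷ y)                                        ∎
  where
  open ≡-Reasoning
  g : List ℕ → ℤ
  g z = when (eqListᵇ z (b ∷ y)) (h z)
  firstLetter : ∀ a → ∑ (λ w → g (a ∷ w)) (words A k) ≡ when (a ≡ᵇ b) (h (b ∷ y))
  firstLetter a with a ≡ᵇ b in eq
  ... | false = ∑-zero (words A k) (λ _ → refl)
  ... | true with ℕ.≡ᵇ⇒≡ a b (≡true⇒T eq)
  ...   | refl = ∑-words-δ A k y (λ w → h (a ∷ w)) uniq y⊆A (ℕ.suc-injective |y|≡)

∑-permsOfSize-δ : ∀ j y (h : List ℕ → ℤ) → IsPerm y →
                  ∑ (λ z → when (eqListᵇ z y) (h z)) (permsOfSize j) ≡ when (j ≡ᵇ length y) (h y)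
∑-permsOfSize-δ j y h py =
  trans (∑-filter g isPermᵇ (words (upTo j) j))
        (trans (∑-cong (words (upTo j) j) (λ {z} _ → perm-redundant z)) (by-size (j ≡ᵇ length y) refl))
  where
  g : List ℕ → ℤ
  g z = when (eqListᵇ z y) (h z)
  perm-redundant : ∀ z → when (isPermᵇ z) (g z) ≡ g z
  perm-redundant z with eqListᵇ z y | eqListᵇ-reflects z y
  ... | false | _ with isPermᵇ z
  ...   | true  = refl
  ...   | false = refl
  perm-redundant z | true | ofʸ refl = cong (λ b → when b (h z)) (T⇒≡true py)
  by-size : ∀ b → (j ≡ᵇ length y) ≡ b → ∑ g (words (upTo j) j) ≡ when b (h y)
  by-size true  eq with ℕ.≡ᵇ⇒≡ j (length y) (≡true⇒T eq)
  ... | refl = ∑-words-δ (upTo j) j y h (upTo⁺ j) (All.map ∈-upTo⁺ (isPerm⇒bounded y py)) refl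
  by-size false eq = ∑-zero (words (upTo j) j) wrong-size
    where
    wrong-size : ∀ {z} → z ∈ words (upTo j) j → g z ≡ 0ℤ
    wrong-size {z} z∈ with eqListᵇ z y | eqListᵇ-reflects z y
    ... | false | _      = refl
    ... | true  | ofʸ refl = ⊥-elim (subst T eq (ℕ.≡⇒≡ᵇ j (length y) (sym (words-length (upTo j) j z∈))))

∑-permsUpTo-δ : ∀ m y (h : List ℕ → ℤ) → IsPerm y → length y ≤ m →
                ∑ (λ z → when (eqListᵇ z y) (h z)) (permsUpTo m) ≡ h y
∑-permsUpTo-δ m y h py |y|≤m = begin
  ∑ g (permsUpTo m)                                    ≡⟨ ∑-concatMap g permsOfSize (upTo (suc m)) ⟩
  ∑ (λ j → ∑ g (permsOfSize j)) (upTo (suc m))         ≡⟨ ∑-cong (upTo (suc m)) (λ {j} _ → ∑-permsOfSize-δ j y h py) ⟩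
  ∑ (λ j → when (j ≡ᵇ length y) (h y)) (upTo (suc m))  ≡⟨ ∑-δ-unique (upTo (suc m)) (upTo⁺ (suc m)) (∈-upTo⁺ (s≤s |y|≤m)) ⟩
  h y                                                  ∎
  where
  open ≡-Reasoning
  g : List ℕ → ℤ
  g z = when (eqListᵇ z y) (h z)

∑-upTo-vanishing : ∀ (F : ℕ → ℤ) {n n′} → n ≤′ n′ → (∀ j → n ≤ j → F j ≡ 0ℤ) →
                   ∑ F (upTo n′) ≡ ∑ F (upTo n)
∑-upTo-vanishing F ≤′-refl                 vanish = refl
∑-upTo-vanishing F {n} (≤′-step {n′} n≤′n′) vanish = begin
  ∑ F (upTo (suc n′))          ≡⟨ cong (∑ F) (sym (List.upTo-∷ʳ n′)) ⟩
  ∑ F (upTo n′ ∷ʳ n′)          ≡⟨ ∑-++ F (upTo n′) (n′ ∷ []) ⟩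
  ∑ F (upTo n′) + (F n′ + 0ℤ)  ≡⟨ cong₂ _+_ (∑-upTo-vanishing F n≤′n′ vanish)
                                            (cong (_+ 0ℤ) (vanish n′ (ℕ.≤′⇒≤ n≤′n′))) ⟩
  ∑ F (upTo n) + 0ℤ            ≡⟨ ℤ.+-identityʳ _ ⟩
  ∑ F (upTo n)                 ∎
  where open ≡-Reasoning

∑-permsUpTo-vanishing : ∀ (h : List ℕ → ℤ) {k m} → k ≤ m → (∀ z → k < length z → h z ≡ 0ℤ) →
                        ∑ h (permsUpTo m) ≡ ∑ h (permsUpTo k)
∑-permsUpTo-vanishing h {k} {m} k≤m vanish = begin
  ∑ h (permsUpTo m)                                ≡⟨ ∑-concatMap h permsOfSize (upTo (suc m)) ⟩
  ∑ (λ j → ∑ h (permsOfSize j)) (upTo (suc m))     ≡⟨ ∑-upTo-vanishing _ (ℕ.≤⇒≤′ (s≤s k≤m)) large ⟩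
  ∑ (λ j → ∑ h (permsOfSize j)) (upTo (suc k))     ≡⟨ sym (∑-concatMap h permsOfSize (upTo (suc k))) ⟩
  ∑ h (permsUpTo k)                                ∎
  where
  open ≡-Reasoning
  large : ∀ j → suc k ≤ j → ∑ h (permsOfSize j) ≡ 0ℤ
  large j k<j = ∑-zero (permsOfSize j) (λ {z} z∈ → vanish z (subst (k <_) (sym (proj₂ (∈-permsOfSize⁻ j z∈))) k<j))

-- Intervals and the Möbius function

∈-filterᵇ⁻ : ∀ {p} xs {z} → z ∈ filterᵇ p xs → z ∈ xs × T (p z)
∈-filterᵇ⁻ {p} (x ∷ xs) z∈ with p x in eq | z∈
... | true  | here refl = here refl , ≡true⇒T eq
... | true  | there z∈′ = map₁ there (∈-filterᵇ⁻ {p} xs z∈′)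
... | false | z∈′       = map₁ there (∈-filterᵇ⁻ {p} xs z∈′)

∈-intervalCO⁻ : ∀ x y {z} → z ∈ intervalCO x y → z ∈ permsUpTo (length y) × x ≼ z × z ≼ y × ¬ z ≡ y
∈-intervalCO⁻ x y {z} z∈ with ∈-filterᵇ⁻ {λ z → leqᵇ x z ∧ leqᵇ z y ∧ not (eqListᵇ z y)} (permsUpTo (length y)) z∈
... | z∈B , t = z∈B , ∧-fst t , ∧-fst (∧-snd {leqᵇ x z} t)
              , λ { refl → subst (T ∘ not) (eqListᵇ-refl z) (∧-snd {leqᵇ z y} (∧-snd {leqᵇ x z} t)) }

intervalCO-shorter : ∀ x y {z} → IsPerm y → z ∈ intervalCO x y → length z < length y
intervalCO-shorter x y py z∈ with ∈-intervalCO⁻ x y z∈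
... | z∈B , _ , z≼y , z≢y with ℕ.m≤n⇒m<n∨m≡n (≼⇒length≤ _ y z≼y)
...   | inj₁ |z|<|y| = |z|<|y|
...   | inj₂ |z|≡|y| = ⊥-elim (z≢y (≼-length≡⇒≡ _ y (proj₁ (∈-permsUpTo⁻ (length y) z∈B)) py z≼y |z|≡|y|))

∑-intervalCO-≰ : ∀ x y (f : List ℕ → ℤ) → ¬ x ≼ y → ∑ f (intervalCO x y) ≡ 0ℤ
∑-intervalCO-≰ x y f x⋠y = ∑-zero (intervalCO x y) λ {z} z∈ →
  let _ , x≼z , z≼y , _ = ∈-intervalCO⁻ x y z∈ in ⊥-elim (x⋠y (≼-trans x z y x≼z z≼y))

∑-intervalCC : ∀ x y {m} (f : List ℕ → ℤ) → length y ≤ m →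
               ∑ f (intervalCC x y) ≡ ∑ (λ z → when (leqᵇ x z ∧ leqᵇ z y) (f z)) (permsUpTo m)
∑-intervalCC x y f |y|≤m =
  trans (∑-filterᵇ f (λ z → leqᵇ x z ∧ leqᵇ z y) (permsUpTo (length y)))
        (sym (∑-permsUpTo-vanishing (λ z → when (leqᵇ x z ∧ leqᵇ z y) (f z)) |y|≤m longer))
  where
  longer : ∀ z → length y < length z → when (leqᵇ x z ∧ leqᵇ z y) (f z) ≡ 0ℤ
  longer z |y|<|z| with leqᵇ x z ∧ leqᵇ z y in eq
  ... | false = refl
  ... | true  = ⊥-elim (ℕ.<⇒≱ |y|<|z| (≼⇒length≤ z y (∧-snd {leqᵇ x z} (≡true⇒T eq))))

∑-intervalCC-split : ∀ x y (f : List ℕ → ℤ) → IsPerm y →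
                     ∑ f (intervalCC x y) ≡ ∑ f (intervalCO x y) + when (leqᵇ x y) (f y)
∑-intervalCC-split x y f py = begin
  ∑ f (intervalCC x y)                                     ≡⟨ ∑-filterᵇ f x≼z≼y B ⟩
  ∑ (λ z → when (x≼z≼y z) (f z)) B                         ≡⟨ ∑-cong B (λ {z} _ → split z) ⟩
  ∑ (λ z → below z + at z) B                               ≡⟨ ∑-+ below at B ⟩
  ∑ below B + ∑ at B                                       ≡⟨ cong₂ _+_ (sym (∑-filterᵇ f x≼z≺y B))
                                                                        (∑-permsUpTo-δ (length y) y (λ z → when (x≼z≼y z) (f z)) py ℕ.≤-refl) ⟩
  ∑ f (intervalCO x y) + when (leqᵇ x y ∧ leqᵇ y y) (f y)  ≡⟨ cong (λ b → ∑ f (intervalCO x y) + when b (f y)) x≼y≼y ⟩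
  ∑ f (intervalCO x y) + when (leqᵇ x y) (f y)             ∎
  where
  open ≡-Reasoning
  B = permsUpTo (length y)
  x≼z≼y x≼z≺y : List ℕ → Bool
  x≼z≼y z = leqᵇ x z ∧ leqᵇ z y
  x≼z≺y z = leqᵇ x z ∧ leqᵇ z y ∧ not (eqListᵇ z y)
  below at : List ℕ → ℤ
  below z = when (x≼z≺y z) (f z)
  at    z = when (eqListᵇ z y) (when (x≼z≼y z) (f z))
  split : ∀ z → when (x≼z≼y z) (f z) ≡ below z + at z
  split z = trans (when-split (x≼z≼y z) (eqListᵇ z y) (f z))
                  (cong (λ b → when b (f z) + at z) (∧-assoc (leqᵇ x z) (leqᵇ z y) (not (eqListᵇ z y))))
  x≼y≼y : (leqᵇ x y ∧ leqᵇ y y) ≡ leqᵇ x y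
  x≼y≼y = trans (cong (leqᵇ x y ∧_) (T⇒≡true (≼-refl y))) (∧-identityʳ (leqᵇ x y))

μAux-fuel : ∀ f g x y → IsPerm y → length y < f → length y < g → μAux f x y ≡ μAux g x y
μAux-fuel (suc f) (suc g) x y py |y|<f |y|<g =
  cong (λ s → if leqᵇ x y then (if eqListᵇ x y then 1ℤ else - s) else 0ℤ) (∑-cong (intervalCO x y) λ {z} z∈ →
    let |z|<|y| = intervalCO-shorter x y py z∈
        pz      = proj₁ (∈-permsUpTo⁻ (length y) (proj₁ (∈-intervalCO⁻ x y z∈)))
    in μAux-fuel f g x z pz (ℕ.<-≤-trans |z|<|y| (ℕ.≤-pred |y|<f)) (ℕ.<-≤-trans |z|<|y| (ℕ.≤-pred |y|<g)))

μ-≰ : ∀ x y → ¬ x ≼ y → μ x y ≡ 0ℤ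
μ-≰ x y x⋠y with leqᵇ x y
... | false = refl
... | true  = ⊥-elim (x⋠y _)

μ-refl : ∀ x → μ x x ≡ 1ℤ
μ-refl x rewrite T⇒≡true (≼-refl x) | eqListᵇ-refl x = refl

μ-unfold : ∀ x y → IsPerm y → x ≼ y → ¬ x ≡ y → μ x y ≡ - ∑ (μ x) (intervalCO x y)
μ-unfold x y py x≼y x≢y with leqᵇ x y | x≼y | eqListᵇ x y | eqListᵇ-reflects x y
... | true | _ | true  | ofʸ x≡y = ⊥-elim (x≢y x≡y)
... | true | _ | false | _       = cong -_ (∑-cong (intervalCO x y) λ {z} z∈ →
  μAux-fuel (length y) (suc (length z)) x z (proj₁ (∈-permsUpTo⁻ (length y) (proj₁ (∈-intervalCO⁻ x y z∈))))
            (intervalCO-shorter x y py z∈) (ℕ.n<1+n _))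

∑-intervalCO-refl : ∀ x (f : List ℕ → ℤ) → IsPerm x → ∑ f (intervalCO x x) ≡ 0ℤ
∑-intervalCO-refl x f px = ∑-zero (intervalCO x x) λ {z} z∈ →
  ⊥-elim (ℕ.<⇒≱ (intervalCO-shorter x x px z∈) (≼⇒length≤ x z (proj₁ (proj₂ (∈-intervalCO⁻ x x z∈)))))

∑-intervalCO-μ : ∀ x y → IsPerm y → x ≼ y → ∑ (μ x) (intervalCO x y) ≡ when (eqListᵇ x y) 1ℤ - μ x y
∑-intervalCO-μ x y py x≼y = by-cases (eqListᵇ-reflects x y)
  where
  open ≡-Reasoning
  by-cases : ∀ {b} → Reflects (x ≡ y) b → ∑ (μ x) (intervalCO x y) ≡ when b 1ℤ - μ x y
  by-cases (ofʸ refl) = begin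
    ∑ (μ x) (intervalCO x x)  ≡⟨ ∑-intervalCO-refl x (μ x) py ⟩
    0ℤ                        ≡⟨ sym (ℤ.+-inverseʳ 1ℤ) ⟩
    1ℤ - 1ℤ                   ≡⟨ cong (λ m → 1ℤ - m) (sym (μ-refl x)) ⟩
    1ℤ - μ x x                ∎
  by-cases (ofⁿ x≢y) = begin
    ∑ (μ x) (intervalCO x y)        ≡⟨ sym (ℤ.neg-involutive _) ⟩
    - - ∑ (μ x) (intervalCO x y)    ≡⟨ cong -_ (sym (μ-unfold x y py x≼y x≢y)) ⟩
    - μ x y                         ≡⟨ sym (ℤ.+-identityˡ _) ⟩
    0ℤ - μ x y                      ∎

∑-intervalCC-μ : ∀ x y → IsPerm y → ∑ (μ x) (intervalCC x y) ≡ when (eqListᵇ x y) 1ℤ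
∑-intervalCC-μ x y py with T? (leqᵇ x y)
... | yes x≼y = begin
  ∑ (μ x) (intervalCC x y)                            ≡⟨ ∑-intervalCC-split x y (μ x) py ⟩
  ∑ (μ x) (intervalCO x y) + when (leqᵇ x y) (μ x y)  ≡⟨ cong₂ _+_ (∑-intervalCO-μ x y py x≼y)
                                                                   (cong (λ b → when b (μ x y)) (T⇒≡true x≼y)) ⟩
  (when (eqListᵇ x y) 1ℤ - μ x y) + μ x y             ≡⟨ minus-plus (when (eqListᵇ x y) 1ℤ) (μ x y) ⟩
  when (eqListᵇ x y) 1ℤ                               ∎
  where
  open ≡-Reasoning
  minus-plus : ∀ a m → (a - m) + m ≡ a
  minus-plus = solve-∀
... | no x⋠y = begin
  ∑ (μ x) (intervalCC x y)                            ≡⟨ ∑-intervalCC-split x y (μ x) py ⟩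
  ∑ (μ x) (intervalCO x y) + when (leqᵇ x y) (μ x y)  ≡⟨ cong₂ _+_ (∑-intervalCO-≰ x y (μ x) x⋠y)
                                                                   (cong (λ b → when b (μ x y)) (¬T⇒≡false x⋠y)) ⟩
  0ℤ                                                  ≡⟨ cong (λ b → when b 1ℤ) (sym (¬T⇒≡false x≢y)) ⟩
  when (eqListᵇ x y) 1ℤ                               ∎
  where
  open ≡-Reasoning
  x≢y : ¬ T (eqListᵇ x y)
  x≢y t with eqListᵇ⇒≡ x y t
  ... | refl = x⋠y (≼-refl x)

∑-intervalCO-μ-≼ : ∀ σ π τ → IsPerm π → IsPerm τ → σ ≼ π → τ ≼ π →
  ∑ (λ l → when (leqᵇ l τ) (μ σ l)) (intervalCO σ π) ≡ when (eqListᵇ σ τ) 1ℤ - when (eqListᵇ τ π) (μ σ π)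
∑-intervalCO-μ-≼ σ π τ pπ pτ σ≼π τ≼π = by-cases (eqListᵇ-reflects τ π)
  where
  open ≡-Reasoning
  B = permsUpTo (length π)
  by-cases : ∀ {b} → Reflects (τ ≡ π) b →
    ∑ (λ l → when (leqᵇ l τ) (μ σ l)) (intervalCO σ π) ≡ when (eqListᵇ σ τ) 1ℤ - when b (μ σ π)
  by-cases (ofʸ refl) = trans (∑-cong (intervalCO σ τ) ≼τ-redundant) (∑-intervalCO-μ σ τ pτ σ≼π)
    where
    ≼τ-redundant : ∀ {l} → l ∈ intervalCO σ τ → when (leqᵇ l τ) (μ σ l) ≡ μ σ l
    ≼τ-redundant {l} l∈ = cong (λ b → when b (μ σ l)) (T⇒≡true (proj₁ (proj₂ (proj₂ (∈-intervalCO⁻ σ τ l∈)))))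
  by-cases (ofⁿ τ≢π) = begin
    ∑ (λ l → when (leqᵇ l τ) (μ σ l)) (intervalCO σ π)
      ≡⟨ ∑-filterᵇ _ (λ l → leqᵇ σ l ∧ leqᵇ l π ∧ not (eqListᵇ l π)) B ⟩
    ∑ (λ l → when (leqᵇ σ l ∧ leqᵇ l π ∧ not (eqListᵇ l π)) (when (leqᵇ l τ) (μ σ l))) B
      ≡⟨ ∑-cong B (λ {l} _ → ≺π-redundant l) ⟩
    ∑ (λ l → when (leqᵇ σ l ∧ leqᵇ l τ) (μ σ l)) B
      ≡⟨ sym (∑-intervalCC σ τ (μ σ) (≼⇒length≤ τ π τ≼π)) ⟩
    ∑ (μ σ) (intervalCC σ τ)
      ≡⟨ ∑-intervalCC-μ σ τ pτ ⟩
    when (eqListᵇ σ τ) 1ℤ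
      ≡⟨ sym (ℤ.+-identityʳ _) ⟩
    when (eqListᵇ σ τ) 1ℤ - 0ℤ  ∎
    where
    ≺π-redundant : ∀ l → when (leqᵇ σ l ∧ leqᵇ l π ∧ not (eqListᵇ l π)) (when (leqᵇ l τ) (μ σ l))
                  ≡ when (leqᵇ σ l ∧ leqᵇ l τ) (μ σ l)
    ≺π-redundant l with leqᵇ l τ in l≼τ
    ... | false = trans (when-0 _) (cong (λ b → when b (μ σ l)) (sym (∧-zeroʳ (leqᵇ σ l))))
    ... | true with leqᵇ l π | ≼-trans l τ π (≡true⇒T l≼τ) τ≼π | eqListᵇ l π | eqListᵇ-reflects l π
    ...   | true | _ | false | _        = refl
    ...   | true | _ | true  | ofʸ refl = ⊥-elim (τ≢π (≼-antisym τ l pτ pπ τ≼π (≡true⇒T l≼τ)))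

∑-intervalCO-μ-≼-* : ∀ σ π τ (f : List ℕ → ℤ) → IsPerm π → IsPerm τ → σ ≼ π →
  ∑ (λ l → μ σ l * when (leqᵇ l τ ∧ leqᵇ τ π) (f τ)) (intervalCO σ π)
    ≡ when (eqListᵇ τ σ) (f τ) - when (eqListᵇ τ π) (μ σ π * f τ)
∑-intervalCO-μ-≼-* σ π τ f pπ pτ σ≼π with T? (leqᵇ τ π)
... | yes τ≼π = begin
  ∑ (λ l → μ σ l * when (leqᵇ l τ ∧ leqᵇ τ π) (f τ)) (intervalCO σ π)
    ≡⟨ ∑-cong (intervalCO σ π) (λ {l} _ → summand l) ⟩
  ∑ (λ l → when (leqᵇ l τ) (μ σ l) * f τ) (intervalCO σ π)
    ≡⟨ ∑-*ʳ (f τ) (λ l → when (leqᵇ l τ) (μ σ l)) (intervalCO σ π) ⟩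
  ∑ (λ l → when (leqᵇ l τ) (μ σ l)) (intervalCO σ π) * f τ
    ≡⟨ cong (_* f τ) (∑-intervalCO-μ-≼ σ π τ pπ pτ σ≼π τ≼π) ⟩
  (when (eqListᵇ σ τ) 1ℤ - when (eqListᵇ τ π) (μ σ π)) * f τ
    ≡⟨ when-distrib (eqListᵇ σ τ) (eqListᵇ τ π) (μ σ π) (f τ) ⟩
  when (eqListᵇ σ τ) (f τ) - when (eqListᵇ τ π) (μ σ π * f τ)
    ≡⟨ cong (λ b → when b (f τ) - when (eqListᵇ τ π) (μ σ π * f τ)) (eqListᵇ-sym σ τ) ⟩
  when (eqListᵇ τ σ) (f τ) - when (eqListᵇ τ π) (μ σ π * f τ) ∎
  where
  open ≡-Reasoning
  summand : ∀ l → μ σ l * when (leqᵇ l τ ∧ leqᵇ τ π) (f τ) ≡ when (leqᵇ l τ) (μ σ l) * f τ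
  summand l rewrite T⇒≡true τ≼π | ∧-identityʳ (leqᵇ l τ) = *-when (leqᵇ l τ) (μ σ l) (f τ)
... | no τ⋠π = begin
  ∑ (λ l → μ σ l * when (leqᵇ l τ ∧ leqᵇ τ π) (f τ)) (intervalCO σ π)
    ≡⟨ ∑-zero (intervalCO σ π) (λ {l} _ → summand l) ⟩
  0ℤ - 0ℤ
    ≡⟨ cong₂ (λ b c → when b (f τ) - when c (μ σ π * f τ)) (sym (¬T⇒≡false τ≢σ))
                                                             (sym (¬T⇒≡false τ≢π)) ⟩
  when (eqListᵇ τ σ) (f τ) - when (eqListᵇ τ π) (μ σ π * f τ) ∎
  where
  open ≡-Reasoning
  summand : ∀ l → μ σ l * when (leqᵇ l τ ∧ leqᵇ τ π) (f τ) ≡ 0ℤ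
  summand l rewrite ¬T⇒≡false τ⋠π | ∧-zeroʳ (leqᵇ l τ) = ℤ.*-zeroʳ (μ σ l)
  τ≢σ : ¬ T (eqListᵇ τ σ)
  τ≢σ t with eqListᵇ⇒≡ τ σ t
  ... | refl = τ⋠π σ≼π
  τ≢π : ¬ T (eqListᵇ τ π)
  τ≢π t with eqListᵇ⇒≡ τ π t
  ... | refl = τ⋠π (≼-refl π)

∑-intervalCO-μ-∑-intervalCC : ∀ σ π (f : List ℕ → ℤ) → IsPerm σ → IsPerm π → σ ≼ π →
  ∑ (λ l → μ σ l * ∑ f (intervalCC l π)) (intervalCO σ π) ≡ f σ - μ σ π * f π
∑-intervalCO-μ-∑-intervalCC σ π f pσ pπ σ≼π = begin
  ∑ (λ l → μ σ l * ∑ f (intervalCC l π)) CO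
    ≡⟨ ∑-cong CO (λ {l} _ → cong (μ σ l *_) (∑-intervalCC l π f ℕ.≤-refl)) ⟩
  ∑ (λ l → μ σ l * ∑ (λ τ → when (leqᵇ l τ ∧ leqᵇ τ π) (f τ)) B) CO
    ≡⟨ ∑-cong CO (λ {l} _ → sym (∑-*ˡ (μ σ l) (λ τ → when (leqᵇ l τ ∧ leqᵇ τ π) (f τ)) B)) ⟩
  ∑ (λ l → ∑ (F l) B) CO
    ≡⟨ ∑-comm F CO B ⟩
  ∑ (λ τ → ∑ (λ l → F l τ) CO) B
    ≡⟨ ∑-cong B (λ {τ} τ∈ → ∑-intervalCO-μ-≼-* σ π τ f pπ (proj₁ (∈-permsUpTo⁻ (length π) τ∈)) σ≼π) ⟩
  ∑ (λ τ → when (eqListᵇ τ σ) (f τ) - when (eqListᵇ τ π) (μ σ π * f τ)) B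
    ≡⟨ ∑-minus (λ τ → when (eqListᵇ τ σ) (f τ)) (λ τ → when (eqListᵇ τ π) (μ σ π * f τ)) B ⟩
  ∑ (λ τ → when (eqListᵇ τ σ) (f τ)) B - ∑ (λ τ → when (eqListᵇ τ π) (μ σ π * f τ)) B
    ≡⟨ cong₂ _-_ (∑-permsUpTo-δ (length π) σ f pσ (≼⇒length≤ σ π σ≼π))
                 (∑-permsUpTo-δ (length π) π (λ τ → μ σ π * f τ) pπ ℕ.≤-refl) ⟩
  f σ - μ σ π * f π ∎
  where
  open ≡-Reasoning
  CO = intervalCO σ π
  B  = permsUpTo (length π)
  F : List ℕ → List ℕ → ℤ
  F l τ = μ σ l * when (leqᵇ l τ ∧ leqᵇ τ π) (f τ)

corollary9 : (σ π : List ℕ) → IsPerm σ → IsPerm π →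
    μ σ π ≡ sgn (∣ π ∣ ∸ ∣ σ ∣) * Eℤ σ π
            - sumℤ (map (λ l → μ σ l * sumℤ (map (λ τ → sgn (∣ π ∣ ∸ ∣ τ ∣) * Eℤ τ π) (intervalCC l π))) (intervalCO σ π))
corollary9 σ π pσ pπ with T? (leqᵇ σ π)
... | yes σ≼π = begin
  μ σ π                         ≡⟨ cancel (μ σ π) (g σ) ⟩
  g σ - (g σ - μ σ π * 1ℤ)      ≡⟨ cong (λ v → g σ - (g σ - μ σ π * v)) (sym g-π) ⟩
  g σ - (g σ - μ σ π * g π)     ≡⟨ cong (λ r → g σ - r) (sym (∑-intervalCO-μ-∑-intervalCC σ π g pσ pπ σ≼π)) ⟩
  g σ - ∑ (λ l → μ σ l * ∑ g (intervalCC l π)) (intervalCO σ π) ∎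
  where
  open ≡-Reasoning
  g : List ℕ → ℤ
  g τ = sgn (∣ π ∣ ∸ ∣ τ ∣) * Eℤ τ π
  g-π : g π ≡ 1ℤ
  g-π rewrite ℕ.n∸n≡0 (length π) | E-refl π = refl
  cancel : ∀ m a → m ≡ a - (a - m * 1ℤ)
  cancel = solve-∀
... | no σ⋠π = begin
  μ σ π                                 ≡⟨ μ-≰ σ π σ⋠π ⟩
  0ℤ                                    ≡⟨ sym (trans (ℤ.+-identityʳ _) (ℤ.*-zeroʳ s)) ⟩
  s * 0ℤ - 0ℤ                           ≡⟨ cong₂ (λ e r → s * ℤ.+ e - r) (sym (E-≰ σ π σ⋠π))
                                                                           (sym (∑-intervalCO-≰ σ π _ σ⋠π)) ⟩
  s * Eℤ σ π - ∑ _ (intervalCO σ π)     ∎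
  where
  open ≡-Reasoning
  s = sgn (∣ π ∣ ∸ ∣ σ ∣)
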